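{- With $\triangle_{00},\triangle_{01},\triangle_{10},\triangle_{11}$ as defined below: $\triangle_{00}$ consists of the partitions of dimension $m\ge3$ with $\lambda_1<\lambda_2+\lambda_m$ and $2\lambda_2<\lambda_1+\lambda_3$, together with the partitions $(\lambda_1,\lambda_2)\times[k_1,k_2]$ with $\lambda_1<2\lambda_2$ and $3\lambda_2<2\lambda_1$; $\triangle_{01}$ consists of the partitions of dimension $m\ge3$ with $\lambda_1<\lambda_2+\lambda_m$ and $2\lambda_2>\lambda_1+\lambda_3$, together with the partitions $(\lambda_1,\lambda_2)\times[k_1,k_2]$ with $\lambda_1<2\lambda_2$ and $3\lambda_2>2\lambda_1$; $\triangle_{10}$ consists of the partitions of dimension $m\ge3$ with $\lambda_2+\lambda_m<\lambda_1<\lambda_2+2\lambda_m$, together with the partitions $(\lambda_1,\lambda_2)\times[k_1,k_2]$ with $2\lambda_2<\lambda_1<3\lambda_2$; $\triangle_{11}$ consists of the partitions of dimension $m\ge3$ with $\lambda_1>\lambda_2+2\lambda_m$, together with the partitions $(\lambda_1,\lambda_2)\times[k_1,k_2]$ with $\lambda_1>3\lambda_2$.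
   Context: A partition is written $(\lambda_1,\dots,\lambda_m)\times[k_1,\dots,k_m]$, where $m\ge1$, the parts $\lambda_i$ are integers with $\lambda_1>\dots>\lambda_m>0$ and the multiplicities $k_i$ are positive integers; $m$ is its dimension. Among partitions of dimension $m\ge2$, $\triangle_0$ is the set with $\lambda_1<\lambda_2+\lambda_m$ and $\triangle_1$ the set with $\lambda_1>\lambda_2+\lambda_m$ (for $m=2$, $\lambda_2+\lambda_m$ means $2\lambda_2$). Define $T_0$ on $\triangle_0$ by $T_0(\lambda)=(\lambda_2,\dots,\lambda_m,\lambda_1-\lambda_2)\times[k_1+k_2,k_3,\dots,k_m,k_1]$ (for $m=2$: $(\lambda_2,\lambda_1-\lambda_2)\times[k_1+k_2,k_1]$), and $T_1$ on $\triangle_1$ by $T_1(\lambda)=(\lambda_1-\lambda_m,\lambda_2,\dots,\lambda_m)\times[k_1,\dots,k_{m-1},k_1+k_m]$. The cylinder sets are $\triangle_{ij}=\{\lambda\in\triangle_i: T_i(\lambda)\in\triangle_j\}$ for $i,j\in\{0,1\}$. -}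

module Defs where

open import Data.Nat using (ℕ; zero; suc; _+_; _*_; _∸_; _<_; _>_)
open import Data.Product using (_×_; _,_; proj₁)
open import Data.List using (List; []; _∷_; _++_; [_])
open import Data.Unit using (⊤)
open import Data.Empty using (⊥)

-- A partition (λ₁,…,λₘ)×[k₁,…,kₘ] is encoded as the list of pairs
-- (λ₁ , k₁) ∷ … ∷ (λₘ , kₘ) ∷ [] ; the dimension m is the length.
Partition : Set
Partition = List (ℕ × ℕ)

ValidFrom : ℕ × ℕ → Partition → Set
ValidFrom (l , k) [] = (0 < l) × (0 < k)
ValidFrom (l , k) ((l' , k') ∷ r) = (0 < k) × (l > l') × ValidFrom (l' , k') r

IsPartition : Partition → Set
IsPartition [] = ⊥
IsPartition (p ∷ r) = ValidFrom p r

lastPart : ℕ × ℕ → Partition → ℕ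
lastPart p [] = proj₁ p
lastPart p (q ∷ r) = lastPart q r

Tri0 : Partition → Set
Tri0 ((l1 , k1) ∷ (l2 , k2) ∷ r) = l1 < l2 + lastPart (l2 , k2) r
Tri0 _ = ⊥

Tri1 : Partition → Set
Tri1 ((l1 , k1) ∷ (l2 , k2) ∷ r) = l1 > l2 + lastPart (l2 , k2) r
Tri1 _ = ⊥

T0 : Partition → Partition
T0 ((l1 , k1) ∷ (l2 , k2) ∷ r) = (l2 , k1 + k2) ∷ (r ++ [ (l1 ∸ l2 , k1) ])
T0 λ' = λ'

addLast : ℕ → Partition → Partition
addLast k [] = []
addLast k ((l , k') ∷ []) = (l , k + k') ∷ []
addLast k (x ∷ y ∷ r) = x ∷ addLast k (y ∷ r)

T1 : Partition → Partition
T1 ((l1 , k1) ∷ (l2 , k2) ∷ r) =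
  (l1 ∸ lastPart (l2 , k2) r , k1) ∷ addLast k1 ((l2 , k2) ∷ r)
T1 λ' = λ'

Tri00 Tri01 Tri10 Tri11 : Partition → Set
Tri00 λ' = Tri0 λ' × Tri0 (T0 λ')
Tri01 λ' = Tri0 λ' × Tri1 (T0 λ')
Tri10 λ' = Tri1 λ' × Tri0 (T1 λ')
Tri11 λ' = Tri1 λ' × Tri1 (T1 λ')

Desc00 Desc01 Desc10 Desc11 : Partition → Set
Desc00 ((l1 , _) ∷ (l2 , _) ∷ []) = (l1 < 2 * l2) × (3 * l2 < 2 * l1)
Desc00 ((l1 , _) ∷ (l2 , _) ∷ (l3 , k3) ∷ r) =
  (l1 < l2 + lastPart (l3 , k3) r) × (2 * l2 < l1 + l3)
Desc00 _ = ⊥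
Desc01 ((l1 , _) ∷ (l2 , _) ∷ []) = (l1 < 2 * l2) × (3 * l2 > 2 * l1)
Desc01 ((l1 , _) ∷ (l2 , _) ∷ (l3 , k3) ∷ r) =
  (l1 < l2 + lastPart (l3 , k3) r) × (2 * l2 > l1 + l3)
Desc01 _ = ⊥
Desc10 ((l1 , _) ∷ (l2 , _) ∷ []) = (2 * l2 < l1) × (l1 < 3 * l2)
Desc10 ((l1 , _) ∷ (l2 , _) ∷ (l3 , k3) ∷ r) =
  (l2 + lastPart (l3 , k3) r < l1) × (l1 < l2 + 2 * lastPart (l3 , k3) r)
Desc10 _ = ⊥
Desc11 ((l1 , _) ∷ (l2 , _) ∷ []) = l1 > 3 * l2
Desc11 ((l1 , _) ∷ (l2 , _) ∷ (l3 , k3) ∷ r) = l1 > l2 + 2 * lastPart (l3 , k3) r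
Desc11 _ = ⊥

-- Each cylinder condition "Tᵢ(λ) ∈ △ⱼ" only involves the first two parts of
-- Tᵢ(λ) and its last part, which are read off directly: T₀ appends λ₁ − λ₂,
-- and T₁ replaces λ₁ by λ₁ − λₘ and keeps λₘ last. Since λ₂ ≤ λ₁ (and
-- λₘ ≤ λ₁ on △₁), the truncated subtractions are genuine, and moving them
-- across the inequality gives the linear conditions of the statement.
module Submission where

open import Defs
open import Data.Product using (_×_; _,_; proj₁)
open import Function.Bundles using (_⇔_; mk⇔; Equivalence)
open import Function.Properties.Equivalence using () renaming (refl to ⇔-refl)
open import Function.Related.Propositional using (module EquationalReasoning; equivalence; ≡⇒)
open import Data.Nat using (ℕ; suc; _+_; _*_; _∸_; _<_; _≤_)
open import Data.Nat.Properties
open import Data.List using ([]; _∷_; _++_; [_])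
open import Relation.Binary.PropositionalEquality using (_≡_; refl; sym; trans; cong; cong₂; subst)

open EquationalReasoning {k = equivalence}

lastPart-++ : ∀ p r x → lastPart p (r ++ [ x ]) ≡ proj₁ x
lastPart-++ p []      x = refl
lastPart-++ p (q ∷ r) x = lastPart-++ q r x

lastPart-addLast : ∀ k p q r → lastPart p (addLast k (q ∷ r)) ≡ lastPart q r
lastPart-addLast k p q []      = refl
lastPart-addLast k p q (s ∷ r) = lastPart-addLast k q s r

Tri0-addLast : ∀ a b k l k' r →
  Tri0 ((a , b) ∷ addLast k ((l , k') ∷ r)) ≡ (a < l + lastPart (l , k') r)
Tri0-addLast a b k l k' []      = refl
Tri0-addLast a b k l k' (s ∷ r) = cong (λ L → a < l + L) (lastPart-addLast k (l , k') s r)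

Tri1-addLast : ∀ a b k l k' r →
  Tri1 ((a , b) ∷ addLast k ((l , k') ∷ r)) ≡ (l + lastPart (l , k') r < a)
Tri1-addLast a b k l k' []      = refl
Tri1-addLast a b k l k' (s ∷ r) = cong (λ L → l + L < a) (lastPart-addLast k (l , k') s r)

n+n≡2*n : ∀ n → n + n ≡ 2 * n
n+n≡2*n n = cong (n +_) (sym (+-identityʳ n))

m+n+n≡m+2*n : ∀ m n → m + n + n ≡ m + 2 * n
m+n+n≡m+2*n m n = trans (+-assoc m n n) (cong (m +_) (n+n≡2*n n))

[m∸n]+[m∸n]≡2*m∸2*n : ∀ m n → (m ∸ n) + (m ∸ n) ≡ 2 * m ∸ 2 * n
[m∸n]+[m∸n]≡2*m∸2*n m n = trans (n+n≡2*n (m ∸ n)) (*-distribˡ-∸ 2 m n)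

m+2*n<o⇒m+n<o : ∀ m n {o} → m + 2 * n < o → m + n < o
m+2*n<o⇒m+n<o m n = ≤-<-trans (+-monoʳ-≤ m (m≤m+n n (n + 0)))

<∸⇔+< : ∀ {a b c} → b ≤ a → (c < a ∸ b ⇔ c + b < a)
<∸⇔+< {c = c} b≤a = mk⇔ (m≤o∸n⇒m+n≤o (suc c) b≤a) (m+n≤o⇒m≤o∸n (suc c))

∸<⇔<+ : ∀ {a b c} → b ≤ a → (a ∸ b < c ⇔ a < c + b)
∸<⇔<+ {a} {b} {c} b≤a = mk⇔
  (λ h → subst (_< c + b) (m∸n+n≡m b≤a) (+-monoˡ-< b h))
  (λ h → +-cancelʳ-< b (a ∸ b) c (subst (_< c + b) (sym (m∸n+n≡m b≤a)) h))

module _ {l1 l2 : ℕ} (k1 k2 : ℕ) where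

  Tri0∘T1⇔ : ∀ r → lastPart (l2 , k2) r ≤ l1 →
    Tri0 (T1 ((l1 , k1) ∷ (l2 , k2) ∷ r)) ⇔ l1 < l2 + 2 * lastPart (l2 , k2) r
  Tri0∘T1⇔ r L≤l1 = let L = lastPart (l2 , k2) r in begin
    Tri0 (T1 ((l1 , k1) ∷ (l2 , k2) ∷ r)) ≡⟨ Tri0-addLast (l1 ∸ L) k1 k1 l2 k2 r ⟩
    l1 ∸ L < l2 + L                        ∼⟨ ∸<⇔<+ L≤l1 ⟩
    l1 < l2 + L + L                        ≡⟨ cong (l1 <_) (m+n+n≡m+2*n l2 L) ⟩
    l1 < l2 + 2 * L                        ∎

  Tri1∘T1⇔ : ∀ r → lastPart (l2 , k2) r ≤ l1 →
    Tri1 (T1 ((l1 , k1) ∷ (l2 , k2) ∷ r)) ⇔ l2 + 2 * lastPart (l2 , k2) r < l1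
  Tri1∘T1⇔ r L≤l1 = let L = lastPart (l2 , k2) r in begin
    Tri1 (T1 ((l1 , k1) ∷ (l2 , k2) ∷ r)) ≡⟨ Tri1-addLast (l1 ∸ L) k1 k1 l2 k2 r ⟩
    l2 + L < l1 ∸ L                        ∼⟨ <∸⇔+< L≤l1 ⟩
    l2 + L + L < l1                        ≡⟨ cong (_< l1) (m+n+n≡m+2*n l2 L) ⟩
    l2 + 2 * L < l1                        ∎

  Tri0∘T0⇔-dim2 : l2 ≤ l1 → Tri0 (T0 ((l1 , k1) ∷ (l2 , k2) ∷ [])) ⇔ 3 * l2 < 2 * l1
  Tri0∘T0⇔-dim2 l2≤l1 = begin
    l2 < (l1 ∸ l2) + (l1 ∸ l2) ≡⟨ cong (l2 <_) ([m∸n]+[m∸n]≡2*m∸2*n l1 l2) ⟩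
    l2 < 2 * l1 ∸ 2 * l2       ∼⟨ <∸⇔+< (*-monoʳ-≤ 2 l2≤l1) ⟩
    l2 + 2 * l2 < 2 * l1       ≡⟨⟩
    3 * l2 < 2 * l1            ∎

  Tri1∘T0⇔-dim2 : l2 ≤ l1 → Tri1 (T0 ((l1 , k1) ∷ (l2 , k2) ∷ [])) ⇔ 2 * l1 < 3 * l2
  Tri1∘T0⇔-dim2 l2≤l1 = begin
    (l1 ∸ l2) + (l1 ∸ l2) < l2 ≡⟨ cong (_< l2) ([m∸n]+[m∸n]≡2*m∸2*n l1 l2) ⟩
    2 * l1 ∸ 2 * l2 < l2       ∼⟨ ∸<⇔<+ (*-monoʳ-≤ 2 l2≤l1) ⟩
    2 * l1 < l2 + 2 * l2       ≡⟨⟩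
    2 * l1 < 3 * l2            ∎

  module _ {l3 : ℕ} (k3 : ℕ) where

    Tri0∘T0⇔ : ∀ r → l2 ≤ l1 →
      Tri0 (T0 ((l1 , k1) ∷ (l2 , k2) ∷ (l3 , k3) ∷ r)) ⇔ 2 * l2 < l1 + l3
    Tri0∘T0⇔ r l2≤l1 = begin
      Tri0 (T0 ((l1 , k1) ∷ (l2 , k2) ∷ (l3 , k3) ∷ r))
        ≡⟨ cong (λ L → l2 < l3 + L) (lastPart-++ (l3 , k3) r (l1 ∸ l2 , k1)) ⟩
      l2 < l3 + (l1 ∸ l2)   ≡⟨ cong (l2 <_) (sym (+-∸-assoc l3 l2≤l1)) ⟩
      l2 < l3 + l1 ∸ l2     ∼⟨ <∸⇔+< (≤-trans l2≤l1 (m≤n+m l1 l3)) ⟩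
      l2 + l2 < l3 + l1     ≡⟨ cong₂ _<_ (n+n≡2*n l2) (+-comm l3 l1) ⟩
      2 * l2 < l1 + l3      ∎

    Tri1∘T0⇔ : ∀ r → l2 ≤ l1 →
      Tri1 (T0 ((l1 , k1) ∷ (l2 , k2) ∷ (l3 , k3) ∷ r)) ⇔ l1 + l3 < 2 * l2
    Tri1∘T0⇔ r l2≤l1 = begin
      Tri1 (T0 ((l1 , k1) ∷ (l2 , k2) ∷ (l3 , k3) ∷ r))
        ≡⟨ cong (λ L → l3 + L < l2) (lastPart-++ (l3 , k3) r (l1 ∸ l2 , k1)) ⟩
      l3 + (l1 ∸ l2) < l2   ≡⟨ cong (_< l2) (sym (+-∸-assoc l3 l2≤l1)) ⟩
      l3 + l1 ∸ l2 < l2     ∼⟨ ∸<⇔<+ (≤-trans l2≤l1 (m≤n+m l1 l3)) ⟩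
      l3 + l1 < l2 + l2     ≡⟨ cong₂ _<_ (+-comm l3 l1) (n+n≡2*n l2) ⟩
      l1 + l3 < 2 * l2      ∎

×-⇔ᵈ : ∀ {A B C D : Set} → A ⇔ C → (A → B ⇔ D) → (A × B) ⇔ (C × D)
×-⇔ᵈ A⇔C B⇔D = mk⇔
  (λ (a , b) → to A⇔C a , to (B⇔D a) b)
  (λ (c , d) → let a = from A⇔C c in a , from (B⇔D a) d)
  where open Equivalence

×-⇔-redundantˡ : ∀ {A B D : Set} → (D → A) → (A → B ⇔ D) → (A × B) ⇔ D
×-⇔-redundantˡ D⇒A B⇔D = mk⇔
  (λ (a , b) → to (B⇔D a) b)
  (λ d → D⇒A d , from (B⇔D (D⇒A d)) d)
  where open Equivalence

mainTheorem5 : (λ' : Partition) → IsPartition λ' →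
    (Tri00 λ' ⇔ Desc00 λ') × (Tri01 λ' ⇔ Desc01 λ') ×
    (Tri10 λ' ⇔ Desc10 λ') × (Tri11 λ' ⇔ Desc11 λ')
mainTheorem5 ((l1 , k1) ∷ []) _ =
  mk⇔ (λ ()) (λ ()) , mk⇔ (λ ()) (λ ()) , mk⇔ (λ ()) (λ ()) , mk⇔ (λ ()) (λ ())
mainTheorem5 ((l1 , k1) ∷ (l2 , k2) ∷ []) (_ , l2<l1 , _) =
    ×-⇔ᵈ l1<2l2 (λ _ → Tri0∘T0⇔-dim2 k1 k2 (<⇒≤ l2<l1))
  , ×-⇔ᵈ l1<2l2 (λ _ → Tri1∘T0⇔-dim2 k1 k2 (<⇒≤ l2<l1))
  , ×-⇔ᵈ 2l2<l1 (λ _ → Tri0∘T1⇔ k1 k2 [] (<⇒≤ l2<l1))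
  , ×-⇔-redundantˡ (m+2*n<o⇒m+n<o l2 l2) (λ _ → Tri1∘T1⇔ k1 k2 [] (<⇒≤ l2<l1))
  where
  l1<2l2 : l1 < l2 + l2 ⇔ l1 < 2 * l2
  l1<2l2 = ≡⇒ (cong (l1 <_) (n+n≡2*n l2))
  2l2<l1 : l2 + l2 < l1 ⇔ 2 * l2 < l1
  2l2<l1 = ≡⇒ (cong (_< l1) (n+n≡2*n l2))
mainTheorem5 ((l1 , k1) ∷ (l2 , k2) ∷ (l3 , k3) ∷ r) (_ , l2<l1 , _) =
    ×-⇔ᵈ ⇔-refl (λ _ → Tri0∘T0⇔ k1 k2 k3 r (<⇒≤ l2<l1))
  , ×-⇔ᵈ ⇔-refl (λ _ → Tri1∘T0⇔ k1 k2 k3 r (<⇒≤ l2<l1))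
  , ×-⇔ᵈ ⇔-refl (λ l2+L<l1 → Tri0∘T1⇔ k1 k2 ((l3 , k3) ∷ r) (L≤l1 l2+L<l1))
  , ×-⇔-redundantˡ (m+2*n<o⇒m+n<o l2 L)
                   (λ l2+L<l1 → Tri1∘T1⇔ k1 k2 ((l3 , k3) ∷ r) (L≤l1 l2+L<l1))
  where
  L : ℕ
  L = lastPart (l3 , k3) r
  L≤l1 : l2 + L < l1 → L ≤ l1
  L≤l1 l2+L<l1 = m+n≤o⇒n≤o l2 (<⇒≤ l2+L<l1)
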